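{- There exists a function $g:\mathbb{N}\setminus\{0\}\to\mathbb{N}\setminus\{0\}$ that is (1) increasing, (2) unbounded, (3) not surjective, (4) not computable, and (5) such that there exists an increasing computable function $\rho:\mathbb{N}\setminus\{0\}\to\mathbb{N}\setminus\{0\}$ for which $g\circ\rho$ is computable. -}

module Defs where

open import Data.Nat using (ℕ; zero; suc; _<_)
open import Data.Fin using (Fin)
open import Data.Vec using (Vec; []; _∷_; lookup)
open import Data.Product using (Σ; ∃; _×_)
open import Data.Empty using (⊥)
open import Relation.Nullary using (¬_; Dec)
open import Relation.Binary.PropositionalEquality using (_≡_)

data Code : ℕ → Set where
  Zc   : ∀ {n} → Code n
  Sc   : Code 1
  Pc   : ∀ {n} → Fin n → Code n
  comp : ∀ {m n} → Code m → Vec (Code n) m → Code n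
  prec : ∀ {n} → Code n → Code (suc (suc n)) → Code (suc n)
  mu   : ∀ {n} → Code (suc n) → Code n

mutual
  data Eval : ∀ {n} → Code n → Vec ℕ n → ℕ → Set where
    evZ    : ∀ {n} {xs : Vec ℕ n} → Eval Zc xs 0
    evS    : ∀ {x} → Eval Sc (x ∷ []) (suc x)
    evP    : ∀ {n} (i : Fin n) {xs : Vec ℕ n} → Eval (Pc i) xs (lookup xs i)
    evComp : ∀ {m n} {f : Code m} {gs : Vec (Code n) m} {xs : Vec ℕ n}
               {ys : Vec ℕ m} {z : ℕ} →
             EvalAll gs xs ys → Eval f ys z → Eval (comp f gs) xs z
    evRec0 : ∀ {n} {f : Code n} {g : Code (suc (suc n))} {xs : Vec ℕ n} {z} →
             Eval f xs z → Eval (prec f g) (0 ∷ xs) z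
    evRecS : ∀ {n} {f : Code n} {g : Code (suc (suc n))} {xs : Vec ℕ n} {y r z} →
             Eval (prec f g) (y ∷ xs) r → Eval g (y ∷ r ∷ xs) z →
             Eval (prec f g) (suc y ∷ xs) z
    evMu   : ∀ {n} {f : Code (suc n)} {xs : Vec ℕ n} {y} →
             Eval f (y ∷ xs) 0 →
             (∀ z → z < y → ∃ λ k → Eval f (z ∷ xs) (suc k)) →
             Eval (mu f) xs y

  data EvalAll : ∀ {m n} → Vec (Code n) m → Vec ℕ n → Vec ℕ m → Set where
    []  : ∀ {n} {xs : Vec ℕ n} → EvalAll [] xs []
    _∷_ : ∀ {m n} {g : Code n} {gs : Vec (Code n) m} {xs : Vec ℕ n} {y ys} →
          Eval g xs y → EvalAll gs xs ys → EvalAll (g ∷ gs) xs (y ∷ ys)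

Computable : (ℕ → ℕ) → Set
Computable f = Σ (Code 1) λ c → ∀ x → Eval c (x ∷ []) (f x)

-- Functions ℕ∖{0} → ℕ∖{0} are represented by functions ℕ → ℕ via the
-- shift k ↦ k+1 on both sides: f : ℕ → ℕ represents the map
-- (k+1) ↦ f k + 1.  All properties below are invariant under this
-- (computable, order-preserving) bijection ℕ ≅ ℕ∖{0}.

StrictlyIncreasing : (ℕ → ℕ) → Set
StrictlyIncreasing f = ∀ {m n} → m < n → f m < f n

Unbounded : (ℕ → ℕ) → Set
Unbounded f = ∀ b → ∃ λ n → b < f n

Surjective : (ℕ → ℕ) → Set
Surjective f = ∀ m → ∃ λ n → f n ≡ m

-- Classical logic (the paper's ambient metatheory), as a hypothesis.
ExcludedMiddle : Set₁
ExcludedMiddle = (P : Set) → Dec P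

{-# OPTIONS --safe #-}
-- Take g(n) = 2n + 1 + ε(n) with a bit ε(n) ∈ {0,1} that vanishes at even n.
-- At the odd point x = 2k + 1 the bit is chosen, by excluded middle, to be 1
-- exactly when the program with code k outputs 2x + 1 on x; so g differs from
-- every program somewhere and is not computable.  A bit is smaller than the gap
-- 2 between consecutive values of 2n + 1, so g is strictly increasing, and it
-- never takes the value 0; on even arguments g is the computable map 2n ↦ 4n + 1.
module Submission where

open import Defs
open import Data.Nat using (ℕ; zero; suc; _+_; _<_; _≤_; z≤n; s≤s; s<s)
open import Data.Nat.Properties
  using (<-cmp; ≤-<-trans; <-trans; m≤n⇒m<n∨m≡n; n<1+n; +-suc; +-monoˡ-≤; +-monoʳ-<;
         +-mono-<; m≤n+m; 1+n≢0; 1+n≢n; m+1+n≢0; module ≤-Reasoning)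
open import Data.Nat.Binary.Base using (ℕᵇ; 2[1+_]; 1+[2_]) renaming (zero to 0ᵇ; toℕ to toℕᵇ)
import Data.Nat.Binary.Properties as ℕᵇ
open import Data.Fin using () renaming (zero to fzero; suc to fsuc)
import Data.Fin as Fin
import Data.Fin.Properties as Fin
open import Data.Vec using (Vec; []; _∷_)
open import Data.Product using (Σ; _×_; _,_; proj₂)
open import Data.Sum using (inj₁; inj₂)
open import Function using (_∘_; id)
open import Function.Definitions using (Injective)
open import Relation.Nullary using (¬_; yes; no; contradiction)
open import Relation.Binary.PropositionalEquality
open import Relation.Binary.Definitions using (tri<; tri≈; tri>)

mutual
  Eval-deterministic : ∀ {n} {c : Code n} {xs : Vec ℕ n} {y y′} →
                       Eval c xs y → Eval c xs y′ → y ≡ y′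
  Eval-deterministic evZ evZ = refl
  Eval-deterministic evS evS = refl
  Eval-deterministic (evP i) (evP .i) = refl
  Eval-deterministic (evComp as f) (evComp as′ f′)
    with refl ← EvalAll-deterministic as as′ = Eval-deterministic f f′
  Eval-deterministic (evRec0 f) (evRec0 f′) = Eval-deterministic f f′
  Eval-deterministic (evRecS r g) (evRecS r′ g′)
    with refl ← Eval-deterministic r r′ = Eval-deterministic g g′
  Eval-deterministic (evMu {y = y} zero-at-y pos-below-y) (evMu {y = y′} zero-at-y′ pos-below-y′)
    with <-cmp y y′
  ... | tri< y<y′ _ _ =
    contradiction (Eval-deterministic (proj₂ (pos-below-y′ y y<y′)) zero-at-y) 1+n≢0
  ... | tri≈ _ y≡y′ _ = y≡y′
  ... | tri> _ _ y′<y =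
    contradiction (Eval-deterministic (proj₂ (pos-below-y y′ y′<y)) zero-at-y′) 1+n≢0

  EvalAll-deterministic : ∀ {m n} {gs : Vec (Code n) m} {xs : Vec ℕ n} {ys ys′} →
                          EvalAll gs xs ys → EvalAll gs xs ys′ → ys ≡ ys′
  EvalAll-deterministic [] [] = refl
  EvalAll-deterministic (e ∷ es) (e′ ∷ es′) =
    cong₂ _∷_ (Eval-deterministic e e′) (EvalAll-deterministic es es′)

unary : ℕ → ℕᵇ → ℕᵇ
unary zero    r = 1+[2 r ]
unary (suc n) r = 2[1+ unary n r ]

unary-injective : ∀ m n {r s} → unary m r ≡ unary n s → m ≡ n × r ≡ s
unary-injective zero    zero    refl = refl , refl
unary-injective zero    (suc n) ()
unary-injective (suc m) zero    ()
unary-injective (suc m) (suc n) eq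
  with refl , r≡s ← unary-injective m n (ℕᵇ.2[1+_]-injective eq) = refl , r≡s

-- Reading ℕᵇ as a string of binary digits, encode c r writes c in front of r;
-- this prefix-free form makes the concatenated codes of comp's arguments decodable.
mutual
  encode : ∀ {n} → Code n → ℕᵇ → ℕᵇ
  encode Zc              r = unary 0 r
  encode Sc              r = unary 1 r
  encode (Pc i)          r = unary 2 (unary (Fin.toℕ i) r)
  encode (comp {m} f gs) r = unary 3 (unary m (encode f (encodeAll gs r)))
  encode (prec f g)      r = unary 4 (encode f (encode g r))
  encode (mu f)          r = unary 5 (encode f r)

  encodeAll : ∀ {m n} → Vec (Code n) m → ℕᵇ → ℕᵇ
  encodeAll []       r = r
  encodeAll (g ∷ gs) r = encode g (encodeAll gs r)

mutual
  encode-injective : ∀ {n} (c c′ : Code n) {r r′} →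
                     encode c r ≡ encode c′ r′ → c ≡ c′ × r ≡ r′
  encode-injective Zc Zc refl = refl , refl
  encode-injective Sc Sc refl = refl , refl
  encode-injective (Pc i) (Pc j) eq
    with i≡j , r≡r′ ← unary-injective (Fin.toℕ i) (Fin.toℕ j)
                                       (proj₂ (unary-injective 2 2 eq))
    with refl ← Fin.toℕ-injective i≡j = refl , r≡r′
  encode-injective (comp {m} f gs) (comp {m′} f′ gs′) eq
    with refl , eq₁ ← unary-injective m m′ (proj₂ (unary-injective 3 3 eq))
    with refl , eq₂ ← encode-injective f f′ eq₁
    with refl , r≡r′ ← encodeAll-injective gs gs′ eq₂ = refl , r≡r′
  encode-injective (prec f g) (prec f′ g′) eq
    with refl , eq₁ ← encode-injective f f′ (proj₂ (unary-injective 4 4 eq))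
    with refl , r≡r′ ← encode-injective g g′ eq₁ = refl , r≡r′
  encode-injective (mu f) (mu f′) eq
    with refl , r≡r′ ← encode-injective f f′ (proj₂ (unary-injective 5 5 eq)) = refl , r≡r′
  encode-injective Zc Sc ()
  encode-injective Zc (Pc _) ()
  encode-injective Zc (comp _ _) ()
  encode-injective Zc (prec _ _) ()
  encode-injective Zc (mu _) ()
  encode-injective Sc Zc ()
  encode-injective Sc (Pc _) ()
  encode-injective Sc (comp _ _) ()
  encode-injective Sc (prec _ _) ()
  encode-injective Sc (mu _) ()
  encode-injective (Pc _) Zc ()
  encode-injective (Pc _) Sc ()
  encode-injective (Pc _) (comp _ _) ()
  encode-injective (Pc _) (prec _ _) ()
  encode-injective (Pc _) (mu _) ()
  encode-injective (comp _ _) Zc ()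
  encode-injective (comp _ _) Sc ()
  encode-injective (comp _ _) (Pc _) ()
  encode-injective (comp _ _) (prec _ _) ()
  encode-injective (comp _ _) (mu _) ()
  encode-injective (prec _ _) Zc ()
  encode-injective (prec _ _) Sc ()
  encode-injective (prec _ _) (Pc _) ()
  encode-injective (prec _ _) (comp _ _) ()
  encode-injective (prec _ _) (mu _) ()
  encode-injective (mu _) Zc ()
  encode-injective (mu _) Sc ()
  encode-injective (mu _) (Pc _) ()
  encode-injective (mu _) (comp _ _) ()
  encode-injective (mu _) (prec _ _) ()

  encodeAll-injective : ∀ {m n} (gs gs′ : Vec (Code n) m) {r r′} →
                        encodeAll gs r ≡ encodeAll gs′ r′ → gs ≡ gs′ × r ≡ r′
  encodeAll-injective []       []         eq = refl , eq
  encodeAll-injective (g ∷ gs) (g′ ∷ gs′) eq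
    with refl , eq₁ ← encode-injective g g′ eq
    with refl , r≡r′ ← encodeAll-injective gs gs′ eq₁ = refl , r≡r′

code : ∀ {n} → Code n → ℕ
code c = toℕᵇ (encode c 0ᵇ)

code-injective : ∀ {n} → Injective _≡_ _≡_ (code {n})
code-injective {x = c} {y = c′} eq
  with refl , _ ← encode-injective c c′ (ℕᵇ.toℕ-injective eq) = refl

add : Code 2
add = prec (Pc fzero) (comp Sc (Pc (fsuc fzero) ∷ []))

add-correct : ∀ m n → Eval add (m ∷ n ∷ []) (m + n)
add-correct zero    n = evRec0 (evP fzero)
add-correct (suc m) n = evRecS (add-correct m n) (evComp (evP (fsuc fzero) ∷ []) evS)

Computable-id : Computable id
Computable-id = Pc fzero , λ _ → evP fzero

Computable-suc∘ : ∀ {f} → Computable f → Computable (suc ∘ f)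
Computable-suc∘ (c , ev) = comp Sc (c ∷ []) , λ x → evComp (ev x ∷ []) evS

Computable-+ : ∀ {f h} → Computable f → Computable h → Computable (λ x → f x + h x)
Computable-+ {f} {h} (c , ev) (d , ev′) =
  comp add (c ∷ d ∷ []) , λ x → evComp (ev x ∷ ev′ x ∷ []) (add-correct (f x) (h x))

Computable-resp : ∀ {f h} → (∀ x → f x ≡ h x) → Computable f → Computable h
Computable-resp f≗h (c , ev) = c , λ x → subst (Eval c (x ∷ [])) (f≗h x) (ev x)

suc-step⇒StrictlyIncreasing : ∀ {f} → (∀ n → f n < f (suc n)) → StrictlyIncreasing f
suc-step⇒StrictlyIncreasing {f} step {m} {suc n} (s≤s m≤n) with m≤n⇒m<n∨m≡n m≤n
... | inj₁ m<n  = <-trans (suc-step⇒StrictlyIncreasing step m<n) (step n)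
... | inj₂ refl = step n

StrictlyIncreasing⇒inflationary : ∀ {f} → StrictlyIncreasing f → ∀ n → n ≤ f n
StrictlyIncreasing⇒inflationary f↑ zero    = z≤n
StrictlyIncreasing⇒inflationary f↑ (suc n) =
  ≤-<-trans (StrictlyIncreasing⇒inflationary f↑ n) (f↑ (n<1+n n))

StrictlyIncreasing⇒Unbounded : ∀ {f} → StrictlyIncreasing f → Unbounded f
StrictlyIncreasing⇒Unbounded f↑ b = suc b , StrictlyIncreasing⇒inflationary f↑ (suc b)

bit+odd-strictlyIncreasing : ∀ {ε : ℕ → ℕ} → (∀ n → ε n ≤ 1) →
                             StrictlyIncreasing (λ n → ε n + suc (n + n))
bit+odd-strictlyIncreasing {ε} ε≤1 = suc-step⇒StrictlyIncreasing step
  where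
  open ≤-Reasoning
  step : ∀ n → ε n + suc (n + n) < ε (suc n) + suc (suc n + suc n)
  step n = begin-strict
    ε n + suc (n + n)                ≤⟨ +-monoˡ-≤ (suc (n + n)) (ε≤1 n) ⟩
    suc (suc (n + n))                <⟨ s<s (s<s (+-monoʳ-< n (n<1+n n))) ⟩
    suc (suc (n + suc n))            ≤⟨ m≤n+m (suc (suc (n + suc n))) (ε (suc n)) ⟩
    ε (suc n) + suc (suc n + suc n)  ∎

onOdd : (ℕ → ℕ) → ℕ → ℕ
onOdd d zero          = 0
onOdd d (suc zero)    = d 0
onOdd d (suc (suc n)) = onOdd (d ∘ suc) n

onOdd-even : ∀ d k → onOdd d (k + k) ≡ 0
onOdd-even d zero = refl
onOdd-even d (suc k) rewrite +-suc k k = onOdd-even (d ∘ suc) k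

onOdd-odd : ∀ d k → onOdd d (suc (k + k)) ≡ d k
onOdd-odd d zero = refl
onOdd-odd d (suc k) rewrite +-suc k k = onOdd-odd (d ∘ suc) k

onOdd-≤ : ∀ {d b} → (∀ k → d k ≤ b) → ∀ n → onOdd d n ≤ b
onOdd-≤ d≤b zero          = z≤n
onOdd-≤ d≤b (suc zero)    = d≤b 0
onOdd-≤ d≤b (suc (suc n)) = onOdd-≤ (d≤b ∘ suc) n

CodeOutputs : ℕ → ℕ → ℕ → Set
CodeOutputs k x y = Σ (Code 1) λ c → code c ≡ k × Eval c (x ∷ []) y

module Diagonal (em : ExcludedMiddle) (base point : ℕ → ℕ) where

  bit : ℕ → ℕ
  bit k with em (CodeOutputs k (point k) (base (point k)))
  ... | yes _ = 1
  ... | no  _ = 0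

  bit≤1 : ∀ k → bit k ≤ 1
  bit≤1 k with em (CodeOutputs k (point k) (base (point k)))
  ... | yes _ = s≤s z≤n
  ... | no  _ = z≤n

  ¬Computable : ∀ {f} → (∀ k → f (point k) ≡ bit k + base (point k)) → ¬ Computable f
  ¬Computable {f} f-at-point (c , ev)
    with em (CodeOutputs (code c) (point (code c)) (base (point (code c)))) | f-at-point (code c)
  ... | yes (c′ , code-c′≡code-c , ev′) | f≡1+base
    with refl ← code-injective {x = c′} {y = c} code-c′≡code-c =
      1+n≢n (sym (trans (Eval-deterministic ev′ (ev (point (code c)))) f≡1+base))
  ... | no ¬outputs | f≡base =
    ¬outputs (c , refl , subst (Eval c _) f≡base (ev (point (code c))))

lemma2 : ExcludedMiddle →
    Σ (ℕ → ℕ) λ g →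
      StrictlyIncreasing g × Unbounded g × ¬ Surjective g × ¬ Computable g ×
      Σ (ℕ → ℕ) λ ρ → StrictlyIncreasing ρ × Computable ρ × Computable (g ∘ ρ)
lemma2 em =
  g , g↑ , StrictlyIncreasing⇒Unbounded g↑ , (λ surj → m+1+n≢0 _ (proj₂ (surj 0))) ,
  ¬Computable g-at-odd ,
  double , (λ m<n → +-mono-< m<n m<n) , Computable-double ,
  Computable-resp g-at-even Computable-4n+1
  where
  odd double : ℕ → ℕ
  odd n    = suc (n + n)
  double n = n + n

  open Diagonal em odd odd

  ε : ℕ → ℕ
  ε = onOdd bit

  g : ℕ → ℕ
  g n = ε n + odd n

  g↑ : StrictlyIncreasing g
  g↑ = bit+odd-strictlyIncreasing (onOdd-≤ bit≤1)

  g-at-odd : ∀ k → g (odd k) ≡ bit k + odd (odd k)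
  g-at-odd k = cong (_+ odd (odd k)) (onOdd-odd _ k)

  g-at-even : ∀ n → odd (double n) ≡ g (double n)
  g-at-even n = cong (_+ odd (double n)) (sym (onOdd-even _ n))

  Computable-double : Computable double
  Computable-double = Computable-+ Computable-id Computable-id

  Computable-4n+1 : Computable (odd ∘ double)
  Computable-4n+1 = Computable-suc∘ (Computable-+ Computable-double Computable-double)
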